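{- For every partition $\mu$, the set of standard fillings $T$ of the Young diagram of $\mu$ with $\mathrm{comaj}(T)=\mathrm{inv}(T)=0$ is $\mathrm{SYT}(\mu)$.
   Context: For a partition $\mu$ of $N$, the Young diagram has cells $(r,1),\dots,(r,\mu_r)$ in row $r$, rows numbered bottom to top. A standard filling is a bijection from the cells to $\{1,\dots,N\}$. The leg of a cell is the number of cells weakly above it in its column. $\mathrm{comaj}(T)$ is the sum of the legs of all cells not in row 1 whose entry is less than the entry immediately below. $\mathrm{inv}(T)$ is the number of inversion triples: (i) pairs of cells $(1,j),(1,j')$ in the bottom row with $j<j'$ and the entry of $(1,j)$ larger; (ii) triples $TL=(r,j)$, $TR=(r,j')$, $BL=(r-1,j)$ with $r\ge 2$, $j<j'$, whose increasing order of entries is $(BL,TR,TL)$, $(TR,TL,BL)$ or $(TL,BL,TR)$ (counterclockwise). $\mathrm{SYT}(\mu)$ is the set of standard Young tableaux: standard fillings with rows increasing left to right and columns increasing bottom to top. -}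

module Defs where

open import Data.Nat using (ℕ; zero; suc; _+_; _<_; _≤_; _<ᵇ_; _<?_)
open import Data.Nat.Properties using ()
open import Data.Bool using (Bool; true; false; if_then_else_; _∧_; _∨_)
open import Data.Nat.ListAction using (sum)
open import Data.List using (List; []; _∷_; length; map; concatMap; upTo; filter; applyUpTo)
open import Data.Fin using (Fin; toℕ)
open import Data.Product using (Σ; _×_; _,_; proj₁; proj₂)
open import Relation.Nullary using (yes; no)
open import Function.Bundles using (_⤖_; Bijection)

-- A partition is a list of positive, weakly decreasing parts
-- (μ₁ ≥ μ₂ ≥ … ≥ μ_ℓ > 0).  Rows are 0-indexed here: row 0 is the
-- paper's row 1 (the bottom row), columns are 0-indexed as well.

data Decreasing : List ℕ → Set where
  dec-[]  : Decreasing []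
  dec-one : ∀ {a} → Decreasing (a ∷ [])
  dec-∷   : ∀ {a b l} → b ≤ a → Decreasing (b ∷ l) → Decreasing (a ∷ b ∷ l)

data AllPositive : List ℕ → Set where
  pos-[] : AllPositive []
  pos-∷  : ∀ {a l} → 0 < a → AllPositive l → AllPositive (a ∷ l)

IsPartition : List ℕ → Set
IsPartition μ = Decreasing μ × AllPositive μ

rowLen : List ℕ → ℕ → ℕ
rowLen []      _       = 0
rowLen (a ∷ _) zero    = a
rowLen (_ ∷ l) (suc r) = rowLen l r

size : List ℕ → ℕ
size = sum

Cell : List ℕ → Set
Cell μ = Σ (ℕ × ℕ) (λ rj → proj₂ rj < rowLen μ (proj₁ rj))

cells : List ℕ → List (ℕ × ℕ)
cells μ = concatMap (λ r → map (λ j → (r , j)) (upTo (rowLen μ r))) (upTo (length μ))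

-- A standard filling: a bijection from the cells onto {1,…,N};
-- represented as a bijection onto Fin N, entry of a cell = 1 + toℕ value.
Filling : List ℕ → Set
Filling μ = Cell μ ⤖ Fin (size μ)

entry : ∀ μ → Filling μ → ℕ → ℕ → ℕ
entry μ T r j with j <? rowLen μ r
... | yes p = suc (toℕ (Bijection.to T ((r , j) , p)))
... | no  _ = 0

count : ∀ {A : Set} → (A → Bool) → List A → ℕ
count p []       = 0
count p (x ∷ xs) = (if p x then 1 else 0) + count p xs

-- leg of (r , j): number of cells weakly above it in its column
leg : List ℕ → ℕ → ℕ → ℕ
leg μ r j = count (λ r' → (r <ᵇ suc r') ∧ (j <ᵇ rowLen μ r')) (upTo (length μ))

comajTerm : ∀ μ → Filling μ → ℕ × ℕ → ℕ
comajTerm μ T (zero  , j) = 0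
comajTerm μ T (suc r , j) =
  if entry μ T (suc r) j <ᵇ entry μ T r j then leg μ (suc r) j else 0

comaj : ∀ μ → Filling μ → ℕ
comaj μ T = sum (map (comajTerm μ T) (cells μ))

-- counterclockwise order of (TL , TR , BL): increasing order is
-- (BL,TR,TL), (TR,TL,BL) or (TL,BL,TR)
ccw : ℕ → ℕ → ℕ → Bool
ccw tl tr bl = ((bl <ᵇ tr) ∧ (tr <ᵇ tl))
             ∨ ((tr <ᵇ tl) ∧ (tl <ᵇ bl))
             ∨ ((tl <ᵇ bl) ∧ (bl <ᵇ tr))

invPair : ∀ μ → Filling μ → ℕ → ℕ → ℕ → Bool
invPair μ T zero    j j' = entry μ T zero j' <ᵇ entry μ T zero j
invPair μ T (suc r) j j' = ccw (entry μ T (suc r) j) (entry μ T (suc r) j') (entry μ T r j)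

invTerm : ∀ μ → Filling μ → ℕ × ℕ → ℕ
invTerm μ T (r , j) =
  count (λ j' → (j <ᵇ j') ∧ invPair μ T r j j') (upTo (rowLen μ r))

inv : ∀ μ → Filling μ → ℕ
inv μ T = sum (map (invTerm μ T) (cells μ))

IsSYT : ∀ μ → Filling μ → Set
IsSYT μ T =
  (∀ r j → suc j < rowLen μ r → entry μ T r j < entry μ T r (suc j)) ×
  (∀ r j → j < rowLen μ (suc r) → entry μ T r j < entry μ T (suc r) j)

-- If comaj T = 0 then no cell lies below a larger entry, because every cell
-- above the bottom row has a positive leg (it counts itself): columns increase.
-- If moreover inv T = 0, the bottom row has no inversions, so it increases, and
-- each higher row increases by induction: below a pair TL, TR of adjacent cells
-- sit BL < BR, and BR < TR by the column condition, so TR < TL would make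
-- (BL, TR, TL) a counterclockwise triple.  Conversely, in a standard Young
-- tableau no cell is smaller than the one below it, and every triple is
-- ordered BL < TL < TR, which is clockwise.
module Submission where

open import Defs
open import Data.Bool using (Bool; true; false; _∧_; T)
open import Data.Bool.Properties using (¬-not; T-≡)
open import Data.Fin using (toℕ)
open import Data.Fin.Properties using (toℕ-injective)
open import Data.List using (List; []; _∷_; length; map; upTo)
open import Data.List.Membership.Propositional using (_∈_; lose)
open import Data.List.Membership.Propositional.Properties
  using (∈-concatMap⁺; ∈-concatMap⁻; ∈-map⁺; ∈-map⁻; ∈-upTo⁺; ∈-upTo⁻)
open import Data.List.Relation.Unary.Any using (here; there; satisfied)
open import Data.Nat using (ℕ; zero; suc; _+_; _<_; _≤_; _<ᵇ_; _<?_; z≤n; s≤s)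
open import Data.Nat.ListAction using (sum)
open import Data.Nat.Properties
open import Data.Product using (_×_; _,_; proj₁; proj₂)
open import Data.Sum using (inj₁; inj₂)
open import Function using (_∘′_)
open import Function.Bundles using (_⇔_; mk⇔; Bijection; Equivalence)
open import Relation.Binary.PropositionalEquality
open import Relation.Nullary using (¬_; yes; no; contradiction)

<ᵇ≡true : ∀ {m n} → m < n → (m <ᵇ n) ≡ true
<ᵇ≡true m<n = Equivalence.to T-≡ (<⇒<ᵇ m<n)

<ᵇ≡false : ∀ {m n} → n ≤ m → (m <ᵇ n) ≡ false
<ᵇ≡false n≤m = ¬-not λ e → ≤⇒≯ n≤m (<ᵇ⇒< _ _ (Equivalence.from T-≡ e))

<ᵇ≡false⇒≮ : ∀ {m n} → (m <ᵇ n) ≡ false → ¬ m < n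
<ᵇ≡false⇒≮ e m<n = subst T e (<⇒<ᵇ m<n)

sum-map≡0⇒ : ∀ {A : Set} (f : A → ℕ) xs → sum (map f xs) ≡ 0 → ∀ {x} → x ∈ xs → f x ≡ 0
sum-map≡0⇒ f (y ∷ ys) e (here refl) = m+n≡0⇒m≡0 (f y) e
sum-map≡0⇒ f (y ∷ ys) e (there x∈ys) = sum-map≡0⇒ f ys (m+n≡0⇒n≡0 (f y) e) x∈ys

sum-map≡0⇐ : ∀ {A : Set} (f : A → ℕ) xs → (∀ {x} → x ∈ xs → f x ≡ 0) → sum (map f xs) ≡ 0
sum-map≡0⇐ f []       h = refl
sum-map≡0⇐ f (y ∷ ys) h = cong₂ _+_ (h (here refl)) (sum-map≡0⇐ f ys (h ∘′ there))

count≡0⇒ : ∀ {A : Set} (p : A → Bool) xs → count p xs ≡ 0 → ∀ {x} → x ∈ xs → p x ≡ false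
count≡0⇒ p (y ∷ ys) e (here refl) with p y
... | false = refl
count≡0⇒ p (y ∷ ys) e (there x∈ys) with p y
... | false = count≡0⇒ p ys e x∈ys

count≡0⇐ : ∀ {A : Set} (p : A → Bool) xs → (∀ {x} → x ∈ xs → p x ≡ false) → count p xs ≡ 0
count≡0⇐ p []       h = refl
count≡0⇐ p (y ∷ ys) h rewrite h (here refl) = count≡0⇐ p ys (λ x∈ys → h (there x∈ys))

increasing-steps⇒increasing : ∀ (f : ℕ → ℕ) n → (∀ j → suc j < n → f j < f (suc j)) →
                              ∀ {j k} → j < k → k < n → f j < f k
increasing-steps⇒increasing f n step {j} {suc k} (s≤s j≤k) k<n with m≤n⇒m<n∨m≡n j≤k
... | inj₂ refl = step j k<n
... | inj₁ j<k  =
  <-trans (increasing-steps⇒increasing f n step j<k (<-trans (n<1+n k) k<n)) (step k k<n)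

ccw-BL<TR<TL : ∀ {tl tr bl} → bl < tr → tr < tl → ccw tl tr bl ≡ true
ccw-BL<TR<TL bl<tr tr<tl rewrite <ᵇ≡true bl<tr | <ᵇ≡true tr<tl = refl

ccw-BL<TL<TR : ∀ {tl tr bl} → bl < tl → tl < tr → ccw tl tr bl ≡ false
ccw-BL<TL<TR bl<tl tl<tr
  rewrite <ᵇ≡true (<-trans bl<tl tl<tr) | <ᵇ≡false (<⇒≤ tl<tr) | <ᵇ≡false (<⇒≤ bl<tl) = refl

rowLen⇒<length : ∀ μ {r j} → j < rowLen μ r → r < length μ
rowLen⇒<length (a ∷ μ) {zero}  _   = s≤s z≤n
rowLen⇒<length (a ∷ μ) {suc r} j<ℓ = s≤s (rowLen⇒<length μ j<ℓ)

rowLen-antitone : ∀ {μ} → Decreasing μ → ∀ r → rowLen μ (suc r) ≤ rowLen μ r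
rowLen-antitone dec-[]        r       = z≤n
rowLen-antitone dec-one       r       = z≤n
rowLen-antitone (dec-∷ b≤a d) zero    = b≤a
rowLen-antitone (dec-∷ b≤a d) (suc r) = rowLen-antitone d r

∈-cells⁺ : ∀ μ {r j} → j < rowLen μ r → (r , j) ∈ cells μ
∈-cells⁺ μ {r} j<ℓ = ∈-concatMap⁺ (λ r → map (r ,_) (upTo (rowLen μ r)))
  (lose (∈-upTo⁺ (rowLen⇒<length μ j<ℓ)) (∈-map⁺ (r ,_) (∈-upTo⁺ j<ℓ)))

∈-cells⁻ : ∀ μ {r j} → (r , j) ∈ cells μ → j < rowLen μ r
∈-cells⁻ μ rj∈ with satisfied (∈-concatMap⁻ (λ r → map (r ,_) (upTo (rowLen μ r)))
                                            {xs = upTo (length μ)} rj∈)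
... | r , rj∈row with ∈-map⁻ (r ,_) rj∈row
... | j , j∈ , refl = ∈-upTo⁻ j∈

leg≢0 : ∀ μ {r j} → j < rowLen μ r → leg μ r j ≢ 0
leg≢0 μ {r} j<ℓ leg≡0 with count≡0⇒ _ (upTo (length μ)) leg≡0 (∈-upTo⁺ (rowLen⇒<length μ j<ℓ))
... | self-not-counted rewrite <ᵇ≡true (n<1+n r) | <ᵇ≡true j<ℓ with self-not-counted
... | ()

module _ (μ : List ℕ) (T : Filling μ) where
  open Bijection T using (to; injective)

  entry-cell : ∀ {r j} (j<ℓ : j < rowLen μ r) → entry μ T r j ≡ suc (toℕ (to ((r , j) , j<ℓ)))
  entry-cell {r} {j} j<ℓ with j <? rowLen μ r
  ... | yes j<ℓ′ = cong (λ p → suc (toℕ (to ((r , j) , p)))) (<-irrelevant j<ℓ′ j<ℓ)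
  ... | no  j≮ℓ = contradiction j<ℓ j≮ℓ

  entry-injective : ∀ {r j r′ j′} → j′ < rowLen μ r′ →
                    entry μ T r j ≡ entry μ T r′ j′ → (r , j) ≡ (r′ , j′)
  entry-injective {r} {j} j′<ℓ e with j <? rowLen μ r
  ... | no _ = contradiction (trans e (entry-cell j′<ℓ)) 0≢1+n
  ... | yes j<ℓ = cong proj₁ (injective (toℕ-injective (suc-injective (trans e (entry-cell j′<ℓ)))))

  entries-distinct-in-row : ∀ {r j} → suc j < rowLen μ r → entry μ T r j ≢ entry μ T r (suc j)
  entries-distinct-in-row sj<ℓ e = 1+n≢n (sym (cong proj₂ (entry-injective sj<ℓ e)))

  comaj≡0⇒columns-increasing : comaj μ T ≡ 0 →
    ∀ r j → j < rowLen μ (suc r) → entry μ T r j < entry μ T (suc r) j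
  comaj≡0⇒columns-increasing c≡0 r j j<ℓ =
    ≤∧≢⇒< (≮⇒≥ no-descent) (λ e → 1+n≢n (sym (cong proj₁ (entry-injective j<ℓ e))))
    where
    no-descent : ¬ entry μ T (suc r) j < entry μ T r j
    no-descent descent with sum-map≡0⇒ (comajTerm μ T) (cells μ) c≡0 (∈-cells⁺ μ j<ℓ)
    ... | term≡0 rewrite <ᵇ≡true descent = leg≢0 μ j<ℓ term≡0

  inv≡0⇒no-inversions : inv μ T ≡ 0 →
    ∀ r {j j′} → j < j′ → j′ < rowLen μ r → invPair μ T r j j′ ≡ false
  inv≡0⇒no-inversions i≡0 r {j} j<j′ j′<ℓ
    with count≡0⇒ _ (upTo (rowLen μ r))
           (sum-map≡0⇒ (invTerm μ T) (cells μ) i≡0 (∈-cells⁺ μ {r} {j} (<-trans j<j′ j′<ℓ)))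
           (∈-upTo⁺ j′<ℓ)
  ... | pair≡false rewrite <ᵇ≡true j<j′ = pair≡false

  comaj≡0∧inv≡0⇒rows-increasing : comaj μ T ≡ 0 → inv μ T ≡ 0 → Decreasing μ →
    ∀ r j → suc j < rowLen μ r → entry μ T r j < entry μ T r (suc j)
  comaj≡0∧inv≡0⇒rows-increasing c≡0 i≡0 d zero j sj<ℓ =
    ≤∧≢⇒< (≮⇒≥ (<ᵇ≡false⇒≮ (inv≡0⇒no-inversions i≡0 zero (n<1+n j) sj<ℓ)))
          (entries-distinct-in-row sj<ℓ)
  comaj≡0∧inv≡0⇒rows-increasing c≡0 i≡0 d (suc r) j sj<ℓ =
    ≤∧≢⇒< (≮⇒≥ not-ccw) (entries-distinct-in-row sj<ℓ)
    where
    BL<TR : entry μ T r j < entry μ T (suc r) (suc j)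
    BL<TR = <-trans (comaj≡0∧inv≡0⇒rows-increasing c≡0 i≡0 d r j (≤-trans sj<ℓ (rowLen-antitone d r)))
                    (comaj≡0⇒columns-increasing c≡0 r (suc j) sj<ℓ)

    not-ccw : ¬ entry μ T (suc r) (suc j) < entry μ T (suc r) j
    not-ccw TR<TL with trans (sym (ccw-BL<TR<TL BL<TR TR<TL))
                             (inv≡0⇒no-inversions i≡0 (suc r) (n<1+n j) sj<ℓ)
    ... | ()

  module _ (syt : IsSYT μ T) where
    SYT⇒rows-increasing : ∀ r {j j′} → j < j′ → j′ < rowLen μ r → entry μ T r j < entry μ T r j′
    SYT⇒rows-increasing r = increasing-steps⇒increasing (entry μ T r) (rowLen μ r) (proj₁ syt r)

    SYT⇒no-inversions : ∀ r {j j′} → j < j′ → j′ < rowLen μ r → invPair μ T r j j′ ≡ false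
    SYT⇒no-inversions zero j<j′ j′<ℓ = <ᵇ≡false (<⇒≤ (SYT⇒rows-increasing zero j<j′ j′<ℓ))
    SYT⇒no-inversions (suc r) {j} j<j′ j′<ℓ =
      ccw-BL<TL<TR (proj₂ syt r j (<-trans j<j′ j′<ℓ)) (SYT⇒rows-increasing (suc r) j<j′ j′<ℓ)

    SYT⇒comaj≡0 : comaj μ T ≡ 0
    SYT⇒comaj≡0 = sum-map≡0⇐ (comajTerm μ T) (cells μ) term≡0
      where
      term≡0 : ∀ {x} → x ∈ cells μ → comajTerm μ T x ≡ 0
      term≡0 {zero  , j} _   = refl
      term≡0 {suc r , j} rj∈ rewrite <ᵇ≡false (<⇒≤ (proj₂ syt r j (∈-cells⁻ μ rj∈))) = refl

    SYT⇒inv≡0 : inv μ T ≡ 0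
    SYT⇒inv≡0 = sum-map≡0⇐ (invTerm μ T) (cells μ) term≡0
      where
      term≡0 : ∀ {x} → x ∈ cells μ → invTerm μ T x ≡ 0
      term≡0 {r , j} _ = count≡0⇐ _ (upTo (rowLen μ r)) (λ j′∈ → pair≡false (∈-upTo⁻ j′∈))
        where
        pair≡false : ∀ {j′} → j′ < rowLen μ r → ((j <ᵇ j′) ∧ invPair μ T r j j′) ≡ false
        pair≡false {j′} j′<ℓ with j <? j′
        ... | yes j<j′ rewrite <ᵇ≡true j<j′ = SYT⇒no-inversions r j<j′ j′<ℓ
        ... | no  j≮j′ rewrite <ᵇ≡false (≮⇒≥ j≮j′) = refl

proposition5p3 : (μ : List ℕ) → IsPartition μ → (T : Filling μ) →
    ((comaj μ T ≡ 0 × inv μ T ≡ 0) ⇔ IsSYT μ T)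
proposition5p3 μ (decreasing , _) T = mk⇔
  (λ (c≡0 , i≡0) → comaj≡0∧inv≡0⇒rows-increasing μ T c≡0 i≡0 decreasing
                 , comaj≡0⇒columns-increasing μ T c≡0)
  (λ syt → SYT⇒comaj≡0 μ T syt , SYT⇒inv≡0 μ T syt)
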